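{- If $G$ is a connected graph of order $n$ with diameter $d$ and a resolving set of size $k$, then $n\leq (dk+1)^{dvc^*(G)}+1$.
   Context: Graphs are finite and simple. A resolving set of $G$ is a set $R$ of vertices such that for every pair $u\neq v$ there is $x\in R$ with $d(x,u)\neq d(x,v)$. The distance hypergraph $\mathcal{H}(G)$ has vertex set $V(G)$ and as hyperedges all balls $B(v,r)=\{u:d(u,v)\leq r\}$, $v\in V(G)$, $r\geq 0$ integer. For a hypergraph, a set $X$ of vertices is shattered if $\{e\cap X\}$ over hyperedges $e$ has $2^{|X|}$ elements, and the VC dimension is the maximum size of a shattered set. The dual hypergraph has the hyperedges as vertices and, for each original vertex $v$, a hyperedge consisting of the hyperedges containing $v$. The dual distance-VC dimension $dvc^*(G)$ is the VC dimension of the dual of $\mathcal{H}(G)$. -}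

module Defs where

open import Data.Nat using (ℕ; zero; suc; _≤_; _<_)
open import Data.Fin using (Fin)
open import Data.Fin.Subset using (Subset; _∈_; ∣_∣)
open import Data.Bool using (Bool; true; false)
open import Data.Product using (Σ; ∃; ∃-syntax; _×_; _,_)
open import Relation.Binary.PropositionalEquality using (_≡_; _≢_)
open import Relation.Nullary using (¬_)
open import Function.Bundles using (_⇔_)

record Graph (n : ℕ) : Set where
  field
    adj    : Fin n → Fin n → Bool
    sym    : ∀ u v → adj u v ≡ adj v u
    irrefl : ∀ u → adj u u ≡ false

open Graph public

module _ {n : ℕ} (G : Graph n) where

  data Walk : Fin n → Fin n → ℕ → Set where
    nil  : ∀ {u} → Walk u u zero
    cons : ∀ {u w v ℓ} → adj G u w ≡ true → Walk w v ℓ → Walk u v (suc ℓ)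

  DistIs : Fin n → Fin n → ℕ → Set
  DistIs u v m = Walk u v m × (∀ ℓ → ℓ < m → ¬ Walk u v ℓ)

  Connected : Set
  Connected = ∀ u v → ∃[ m ] Walk u v m

  IsDiameter : ℕ → Set
  IsDiameter d = (∀ u v → ∃[ m ] (DistIs u v m × m ≤ d))
               × (∃[ u ] ∃[ v ] DistIs u v d)

  Resolving : Subset n → Set
  Resolving R = ∀ u v → u ≢ v →
    ∃[ x ] (x ∈ R × ∃[ a ] ∃[ b ] (DistIs x u a × DistIs x v b × a ≢ b))

  InBall : Fin n → ℕ → Fin n → Set
  InBall v r u = ∃[ m ] (m ≤ r × DistIs v u m)

  -- A family of t balls B(c i, ρ i), i : Fin t, which are pairwise distinct
  -- hyperedges of H(G) and form a shattered set in the dual hypergraph: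
  -- for every subfamily S there is a vertex w lying in exactly the balls of S.
  DualShattered : (t : ℕ) → (Fin t → Fin n) → (Fin t → ℕ) → Set
  DualShattered t c ρ =
      (∀ i j → i ≢ j → ¬ (∀ u → InBall (c i) (ρ i) u ⇔ InBall (c j) (ρ j) u))
    × (∀ (S : Subset t) → ∃[ w ] (∀ i → InBall (c i) (ρ i) w ⇔ (i ∈ S)))

  IsDualVCDim : ℕ → Set
  IsDualVCDim D =
      (∃[ c ] ∃[ ρ ] DualShattered D c ρ)
    × (∀ t (c : Fin t → Fin n) (ρ : Fin t → ℕ) → DualShattered t c ρ → t ≤ D)

module Submission where

-- Let x₁, …, x_k enumerate the resolving set and code each vertex w by the set of
-- balls B(xᵢ, r), r < d, that contain it. Since R resolves G, and every distance is at
-- most d, the code is injective: the n vertices give n distinct subsets of a ground set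
-- of kd balls. A set of balls shattered by these codes is shattered in the dual distance
-- hypergraph, so it has at most D = dvc*(G) elements, and the Sauer–Shelah lemma gives
-- n ≤ ∑_{i≤D} (kd choose i) ≤ (kd + 1)^D.

open import Defs
open import Data.Nat using (ℕ; _≤_; _+_; _*_; _^_)
open import Data.Fin.Subset using (Subset; ∣_∣)
open import Data.Product using (∃-syntax; _×_)
open import Relation.Binary.PropositionalEquality using (_≡_)

open import Algebra.Properties.CommutativeSemigroup using (interchange)
import Data.Bool as Bool
open import Data.Bool using (Bool; true; false; T; if_then_else_)
open import Data.Bool.Properties using (T-≡)
open import Data.Fin using (Fin; zero; suc; lift; toℕ; fromℕ<; combine; remQuot) renaming (_≟_ to _≟ᶠ_)
open import Data.Fin.Properties using (suc-injective; 0≢1+n; any?; toℕ-fromℕ<; remQuot-combine)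
open import Data.Fin.Subset using (inside; outside; _∈_; ⁅_⁆)
open import Data.Fin.Subset.Properties using (x∈⁅x⁆; x∈⁅y⁆⇒x≡y)
open import Data.Nat using (zero; suc; z≤n; s≤s; _⊔_; _⊓_; _≤ᵇ_; _<_)
open import Data.Nat.Properties
  using ( +-0-monoid; +-commutativeSemigroup; +-comm; +-identityʳ; *-comm; ^-zeroˡ
        ; ≤-reflexive; ≤-trans; ≤-antisym; ≤-pred; n≤1+n; m≤m+n; n≤0⇒n≡0; ≮⇒≥; <-irrefl; <-cmp; <⇒≱
        ; <-≤-trans; >⇒≢; ≤-total; ≤ᵇ⇒≤; ≤⇒≤ᵇ; +-mono-≤; *-monoʳ-≤; ^-monoˡ-≤
        ; ⊔-sel; ⊔-lub; m⊓n≤m; m⊓n≤n; m≤n⇒m⊔n≡n; m≤n⇒m⊓n≡m; m≥n⇒m⊔n≡m; m≥n⇒m⊓n≡n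
        ; module ≤-Reasoning )
open import Data.Product using (_,_; proj₁; proj₂; map₂)
open import Data.Sum using (_⊎_; inj₁; inj₂)
open import Data.Vec using ([]; _∷_; lookup; tabulate; here; there)
open import Data.Vec.Properties using (≡-dec; lookup∘tabulate; []=⇒lookup; lookup⇒[]=)
open import Function using (_∘_; _⇔_; mk⇔; Equivalence)
open import Function.Definitions using (Injective)
open import Function.Properties.Equivalence using (⇔-setoid)
open import Level using (0ℓ)
open import Relation.Binary.Definitions using (DecidableEquality; tri<; tri≈; tri>)
open import Relation.Binary.PropositionalEquality as ≡
  using (_≢_; _≗_; refl; trans; cong; cong₂; subst; module ≡-Reasoning)
import Relation.Binary.Reasoning.Setoid as SetoidReasoning
open import Relation.Nullary using (¬_; yes; no; does; contradiction)
open import Relation.Nullary.Decidable using (dec-false)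
open import Algebra.Properties.Monoid.Sum +-0-monoid using (sum-syntax)

∑ᶜ : ∀ m → (Subset m → ℕ) → ℕ
∑ᶜ zero    f = f []
∑ᶜ (suc m) f = ∑ᶜ m (f ∘ (inside ∷_)) + ∑ᶜ m (f ∘ (outside ∷_))

∑ᶜ-cong : ∀ m {f g : Subset m → ℕ} → f ≗ g → ∑ᶜ m f ≡ ∑ᶜ m g
∑ᶜ-cong zero    f≗g = f≗g []
∑ᶜ-cong (suc m) f≗g = cong₂ _+_ (∑ᶜ-cong m (f≗g ∘ (inside ∷_))) (∑ᶜ-cong m (f≗g ∘ (outside ∷_)))

∑ᶜ-zero : ∀ m {f : Subset m → ℕ} → (∀ v → f v ≡ 0) → ∑ᶜ m f ≡ 0
∑ᶜ-zero zero    f≡0 = f≡0 []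
∑ᶜ-zero (suc m) f≡0 = cong₂ _+_ (∑ᶜ-zero m (f≡0 ∘ (inside ∷_))) (∑ᶜ-zero m (f≡0 ∘ (outside ∷_)))

∑ᶜ-distrib-+ : ∀ m (f g : Subset m → ℕ) → ∑ᶜ m (λ v → f v + g v) ≡ ∑ᶜ m f + ∑ᶜ m g
∑ᶜ-distrib-+ zero    f g = refl
∑ᶜ-distrib-+ (suc m) f g = trans
  (cong₂ _+_ (∑ᶜ-distrib-+ m (f ∘ (inside ∷_)) (g ∘ (inside ∷_)))
             (∑ᶜ-distrib-+ m (f ∘ (outside ∷_)) (g ∘ (outside ∷_))))
  (interchange +-commutativeSemigroup (∑ᶜ m (f ∘ (inside ∷_))) (∑ᶜ m (g ∘ (inside ∷_)))
                                      (∑ᶜ m (f ∘ (outside ∷_))) (∑ᶜ m (g ∘ (outside ∷_))))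

_≟ˢ_ : ∀ {m} → DecidableEquality (Subset m)
_≟ˢ_ = ≡-dec Bool._≟_

δ : ∀ {m} → Subset m → Subset m → ℕ
δ u v = if does (u ≟ˢ v) then 1 else 0

δ-≢ : ∀ {m} {u v : Subset m} → u ≢ v → δ u v ≡ 0
δ-≢ {u = u} {v} u≢v = cong (if_then 1 else 0) (dec-false (u ≟ˢ v) u≢v)

∑ᶜ-δ : ∀ m (u : Subset m) → ∑ᶜ m (δ u) ≡ 1
∑ᶜ-δ zero    []           = refl
∑ᶜ-δ (suc m) (inside ∷ u)  = cong₂ _+_ (∑ᶜ-δ m u) (∑ᶜ-zero m λ _ → refl)
∑ᶜ-δ (suc m) (outside ∷ u) = cong₂ _+_ (∑ᶜ-zero m λ _ → refl) (∑ᶜ-δ m u)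

Shatters : ∀ {m t} → (Subset m → ℕ) → (Fin t → Fin m) → Set
Shatters {t = t} h e = ∀ (S : Fin t → Bool) → ∃[ v ] (0 < h v × ∀ i → lookup v (e i) ≡ S i)

-- Φ m D = ∑_{i<D} (m choose i), computed by Pascal's rule.
Φ : ℕ → ℕ → ℕ
Φ m       zero    = 0
Φ zero    (suc D) = 1
Φ (suc m) (suc D) = Φ m (suc D) + Φ m D

m+n≡m⊔n+m⊓n : ∀ m n → m + n ≡ m ⊔ n + m ⊓ n
m+n≡m⊔n+m⊓n m n with ≤-total m n
... | inj₁ m≤n rewrite m≤n⇒m⊔n≡n m≤n | m≤n⇒m⊓n≡m m≤n = +-comm m n
... | inj₂ n≤m rewrite m≥n⇒m⊔n≡m n≤m | m≥n⇒m⊓n≡n n≤m = refl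

0<m⊔n⇒0<m⊎0<n : ∀ m n → 0 < m ⊔ n → 0 < m ⊎ 0 < n
0<m⊔n⇒0<m⊎0<n m n 0<m⊔n with ⊔-sel m n
... | inj₁ m⊔n≡m = inj₁ (subst (0 <_) m⊔n≡m 0<m⊔n)
... | inj₂ m⊔n≡n = inj₂ (subst (0 <_) m⊔n≡n 0<m⊔n)

-- Split along the first coordinate: h⊔ is the projected family, h⊓ the sets having
-- both extensions; whatever h⊓ shatters, h shatters together with the first coordinate.
sauer–shelah : ∀ m D (h : Subset m → ℕ) → (∀ v → h v ≤ 1) →
               (∀ {t} (e : Fin t → Fin m) → Shatters h e → t < D) →
               ∑ᶜ m h ≤ Φ m D
sauer–shelah m zero h h≤1 bound =
  ≤-reflexive (∑ᶜ-zero m λ v → n≤0⇒n≡0 (≮⇒≥ λ 0<hv → <-irrefl refl (bound {0} (λ ()) λ _ → v , 0<hv , λ ())))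
sauer–shelah zero    (suc D) h h≤1 bound = h≤1 []
sauer–shelah (suc m) (suc D) h h≤1 bound = begin
  ∑ᶜ m h₁ + ∑ᶜ m h₀                     ≡⟨ ≡.sym (∑ᶜ-distrib-+ m h₁ h₀) ⟩
  ∑ᶜ m (λ v → h₁ v + h₀ v)              ≡⟨ ∑ᶜ-cong m (λ v → m+n≡m⊔n+m⊓n (h₁ v) (h₀ v)) ⟩
  ∑ᶜ m (λ v → h⊔ v + h⊓ v)              ≡⟨ ∑ᶜ-distrib-+ m h⊔ h⊓ ⟩
  ∑ᶜ m h⊔ + ∑ᶜ m h⊓                     ≤⟨ +-mono-≤ (sauer–shelah m (suc D) h⊔ h⊔≤1 bound⊔)
                                                   (sauer–shelah m D h⊓ h⊓≤1 bound⊓) ⟩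
  Φ m (suc D) + Φ m D                   ∎
  where
  open ≤-Reasoning
  h₁ h₀ h⊔ h⊓ : Subset m → ℕ
  h₁ v = h (inside ∷ v)
  h₀ v = h (outside ∷ v)
  h⊔ v = h₁ v ⊔ h₀ v
  h⊓ v = h₁ v ⊓ h₀ v

  h⊔≤1 : ∀ v → h⊔ v ≤ 1
  h⊔≤1 v = ⊔-lub (h≤1 _) (h≤1 _)

  h⊓≤1 : ∀ v → h⊓ v ≤ 1
  h⊓≤1 v = ≤-trans (m⊓n≤m (h₁ v) (h₀ v)) (h≤1 _)

  bound⊔ : ∀ {t} (e : Fin t → Fin m) → Shatters h⊔ e → t < suc D
  bound⊔ e sh = bound (suc ∘ e) witness
    where
    witness : Shatters h (suc ∘ e)
    witness S with sh S
    ... | v , 0<h⊔v , realised with 0<m⊔n⇒0<m⊎0<n (h₁ v) (h₀ v) 0<h⊔v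
    ...   | inj₁ 0<h₁v = inside ∷ v , 0<h₁v , realised
    ...   | inj₂ 0<h₀v = outside ∷ v , 0<h₀v , realised

  bound⊓ : ∀ {t} (e : Fin t → Fin m) → Shatters h⊓ e → t < D
  bound⊓ e sh = ≤-pred (bound (lift 1 e) witness)
    where
    witness : Shatters h (lift 1 e)
    witness S with sh (S ∘ suc)
    ... | v , 0<h⊓v , realised = S zero ∷ v , 0<h (S zero) , extended
      where
      0<h : ∀ b → 0 < h (b ∷ v)
      0<h inside  = <-≤-trans 0<h⊓v (m⊓n≤m (h₁ v) (h₀ v))
      0<h outside = <-≤-trans 0<h⊓v (m⊓n≤n (h₁ v) (h₀ v))
      extended : ∀ i → lookup (S zero ∷ v) (lift 1 e i) ≡ S i
      extended zero    = refl
      extended (suc i) = realised i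

Φ-suc≤suc^ : ∀ m D → Φ m (suc D) ≤ suc m ^ D
Φ-suc≤suc^ zero    D       = ≤-reflexive (≡.sym (^-zeroˡ D))
Φ-suc≤suc^ (suc m) zero    = ≤-reflexive (Φ-one (suc m))
  where
  Φ-one : ∀ m → Φ m 1 ≡ 1
  Φ-one zero    = refl
  Φ-one (suc m) = trans (+-identityʳ (Φ m 1)) (Φ-one m)
Φ-suc≤suc^ (suc m) (suc D) = begin
  Φ m (suc (suc D)) + Φ m (suc D)   ≤⟨ +-mono-≤ (Φ-suc≤suc^ m (suc D)) (Φ-suc≤suc^ m D) ⟩
  suc m ^ suc D + suc m ^ D         ≡⟨ +-comm (suc m * suc m ^ D) (suc m ^ D) ⟩
  suc (suc m) * suc m ^ D           ≤⟨ *-monoʳ-≤ (suc (suc m)) (^-monoˡ-≤ D (n≤1+n (suc m))) ⟩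
  suc (suc m) ^ suc D               ∎
  where open ≤-Reasoning

multiplicity : ∀ {n m} → (Fin n → Subset m) → Subset m → ℕ
multiplicity {n} code v = ∑[ w < n ] δ (code w) v

∑ᶜ-multiplicity : ∀ n {m} (code : Fin n → Subset m) → ∑ᶜ m (multiplicity code) ≡ n
∑ᶜ-multiplicity zero    {m} code = ∑ᶜ-zero m λ _ → refl
∑ᶜ-multiplicity (suc n) {m} code = begin
  ∑ᶜ m (λ v → δ (code zero) v + multiplicity (code ∘ suc) v)
    ≡⟨ ∑ᶜ-distrib-+ m (δ (code zero)) (multiplicity (code ∘ suc)) ⟩
  ∑ᶜ m (δ (code zero)) + ∑ᶜ m (multiplicity (code ∘ suc))
    ≡⟨ cong₂ _+_ (∑ᶜ-δ m (code zero)) (∑ᶜ-multiplicity n (code ∘ suc)) ⟩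
  suc n ∎
  where open ≡-Reasoning

multiplicity-∉ : ∀ {n m} (code : Fin n → Subset m) {v} → (∀ w → code w ≢ v) → multiplicity code v ≡ 0
multiplicity-∉ {zero}  code ∉ = refl
multiplicity-∉ {suc n} code ∉ = cong₂ _+_ (δ-≢ (∉ zero)) (multiplicity-∉ (code ∘ suc) (∉ ∘ suc))

multiplicity-pos : ∀ {n m} (code : Fin n → Subset m) {v} → 0 < multiplicity code v → ∃[ w ] code w ≡ v
multiplicity-pos code {v} 0<μ with any? (λ w → code w ≟ˢ v)
... | yes ∈ = ∈
... | no ∉  = contradiction (multiplicity-∉ code λ w eq → ∉ (w , eq)) (>⇒≢ 0<μ)

multiplicity≤1 : ∀ {n m} (code : Fin n → Subset m) → Injective _≡_ _≡_ code → ∀ v → multiplicity code v ≤ 1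
multiplicity≤1 {zero}  code inj v = z≤n
multiplicity≤1 {suc n} code inj v with code zero ≟ˢ v
... | yes refl = ≤-reflexive (cong suc (multiplicity-∉ (code ∘ suc) λ w → 0≢1+n ∘ ≡.sym ∘ inj))
... | no _     = multiplicity≤1 (code ∘ suc) (suc-injective ∘ inj) v

ShattersImage : ∀ {n m t} → (Fin n → Subset m) → (Fin t → Fin m) → Set
ShattersImage {t = t} code e = ∀ (S : Fin t → Bool) → ∃[ w ] ∀ i → lookup (code w) (e i) ≡ S i

injective-code-bound : ∀ {n m} D (code : Fin n → Subset m) → Injective _≡_ _≡_ code →
                       (∀ {t} (e : Fin t → Fin m) → ShattersImage code e → t ≤ D) →
                       n ≤ suc m ^ D
injective-code-bound {n} {m} D code inj bound = begin
  n                          ≡⟨ ≡.sym (∑ᶜ-multiplicity n code) ⟩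
  ∑ᶜ m (multiplicity code)   ≤⟨ sauer–shelah m (suc D) (multiplicity code) (multiplicity≤1 code inj)
                                               (λ e → s≤s ∘ bound e ∘ shattersImage e) ⟩
  Φ m (suc D)                ≤⟨ Φ-suc≤suc^ m D ⟩
  suc m ^ D                  ∎
  where
  open ≤-Reasoning
  shattersImage : ∀ {t} (e : Fin t → Fin m) → Shatters (multiplicity code) e → ShattersImage code e
  shattersImage e sh S with sh S
  ... | v , 0<μ , realised with multiplicity-pos code 0<μ
  ...   | w , refl = w , realised

members : ∀ {n} (p : Subset n) → Fin ∣ p ∣ → Fin n
members (inside  ∷ p) zero    = zero
members (inside  ∷ p) (suc i) = suc (members p i)
members (outside ∷ p) i       = suc (members p i)

members-onto : ∀ {n} (p : Subset n) {x} → x ∈ p → ∃[ i ] members p i ≡ x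
members-onto (inside  ∷ p) here        = zero , refl
members-onto (inside  ∷ p) (there x∈p) = let i , eq = members-onto p x∈p in suc i , cong suc eq
members-onto (outside ∷ p) (there x∈p) = map₂ (cong suc) (members-onto p x∈p)

DistIs-unique : ∀ {n} (G : Graph n) {u v a b} → DistIs G u v a → DistIs G u v b → a ≡ b
DistIs-unique G (walk-a , a-min) (walk-b , b-min) =
  ≤-antisym (≮⇒≥ λ b<a → a-min _ b<a walk-b) (≮⇒≥ λ a<b → b-min _ a<b walk-a)

distinct-balls : ∀ {n} (G : Graph n) {t} (c : Fin t → Fin n) (ρ : Fin t → ℕ) →
  (∀ (S : Subset t) → ∃[ w ] (∀ i → InBall G (c i) (ρ i) w ⇔ (i ∈ S))) →
  ∀ i j → i ≢ j → ¬ (∀ u → InBall G (c i) (ρ i) u ⇔ InBall G (c j) (ρ j) u)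
distinct-balls G c ρ realise i j i≢j same with realise ⁅ i ⁆
... | w , inBall⇔ = i≢j (≡.sym (x∈⁅y⁆⇒x≡y i (to (inBall⇔ j) (to (same w) (from (inBall⇔ i) (x∈⁅x⁆ i))))))
  where open Equivalence

module ⇔-Reasoning = SetoidReasoning (⇔-setoid 0ℓ)

module BallCode {n} (G : Graph n) {d} (diam : IsDiameter G d) {k} (centres : Fin k → Fin n) where

  dist : Fin n → Fin n → ℕ
  dist u v = proj₁ (proj₁ diam u v)

  dist-DistIs : ∀ u v → DistIs G u v (dist u v)
  dist-DistIs u v = proj₁ (proj₂ (proj₁ diam u v))

  dist≤d : ∀ u v → dist u v ≤ d
  dist≤d u v = proj₂ (proj₂ (proj₁ diam u v))

  InBall⇔≤ᵇ : ∀ x r w → InBall G x r w ⇔ T (dist x w ≤ᵇ r)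
  InBall⇔≤ᵇ x r w = mk⇔
    (λ (m , m≤r , m-dist) → ≤⇒≤ᵇ (subst (_≤ r) (DistIs-unique G m-dist (dist-DistIs x w)) m≤r))
    (λ ≤ᵇ → dist x w , ≤ᵇ⇒≤ (dist x w) r ≤ᵇ , dist-DistIs x w)

  -- Coordinate combine i r stands for the ball B(centres i, r), r < d.
  centre : Fin (k * d) → Fin n
  centre j = centres (proj₁ (remQuot d j))

  radius : Fin (k * d) → ℕ
  radius j = toℕ (proj₂ (remQuot {k} d j))

  code : Fin n → Subset (k * d)
  code w = tabulate λ j → dist (centre j) w ≤ᵇ radius j

  InBall⇔lookup-code : ∀ w j → InBall G (centre j) (radius j) w ⇔ (lookup (code w) j ≡ true)
  InBall⇔lookup-code w j = begin
    InBall G (centre j) (radius j) w          ≈⟨ InBall⇔≤ᵇ (centre j) (radius j) w ⟩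
    T (dist (centre j) w ≤ᵇ radius j)         ≈⟨ T-≡ ⟩
    (dist (centre j) w ≤ᵇ radius j) ≡ true    ≡⟨ cong (_≡ true) (≡.sym (lookup∘tabulate _ j)) ⟩
    lookup (code w) j ≡ true                  ∎
    where open ⇔-Reasoning

  lookup-code-combine : ∀ w i r → lookup (code w) (combine i r) ≡ (dist (centres i) w ≤ᵇ toℕ r)
  lookup-code-combine w i r = trans (lookup∘tabulate _ (combine i r))
    (cong (λ (i′ , r′) → dist (centres i′) w ≤ᵇ toℕ r′) (remQuot-combine i r))

  code-separates : ∀ {w w′} i → dist (centres i) w < dist (centres i) w′ → code w ≢ code w′
  code-separates {w} {w′} i a<b code-eq = <⇒≱ a<b b≤a
    where
    open ≡-Reasoning
    a b : ℕ
    a = dist (centres i) w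
    b = dist (centres i) w′
    -- the ball of radius a is a coordinate because a < b ≤ d
    a<d : a < d
    a<d = <-≤-trans a<b (dist≤d _ _)
    r : Fin d
    r = fromℕ< a<d
    same-bit : (a ≤ᵇ toℕ r) ≡ (b ≤ᵇ toℕ r)
    same-bit = begin
      a ≤ᵇ toℕ r                       ≡⟨ ≡.sym (lookup-code-combine w i r) ⟩
      lookup (code w) (combine i r)    ≡⟨ cong (λ v → lookup v (combine i r)) code-eq ⟩
      lookup (code w′) (combine i r)   ≡⟨ lookup-code-combine w′ i r ⟩
      b ≤ᵇ toℕ r                       ∎
    b≤a : b ≤ a
    b≤a = subst (b ≤_) (toℕ-fromℕ< a<d)
            (≤ᵇ⇒≤ b (toℕ r) (subst T same-bit (≤⇒≤ᵇ (≤-reflexive (≡.sym (toℕ-fromℕ< a<d))))))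

  code-injective : ∀ {R} → Resolving G R → (∀ {x} → x ∈ R → ∃[ i ] centres i ≡ x) → Injective _≡_ _≡_ code
  code-injective resolving onto {w} {w′} code-eq with w ≟ᶠ w′
  ... | yes w≡w′ = w≡w′
  ... | no w≢w′ with resolving w w′ w≢w′
  ...   | x , x∈R , a , b , a-dist , b-dist , a≢b with onto x∈R
  ...     | i , refl with <-cmp (dist (centres i) w) (dist (centres i) w′)
  ...       | tri< a<b _ _ = contradiction code-eq (code-separates i a<b)
  ...       | tri> _ _ b<a = contradiction (≡.sym code-eq) (code-separates i b<a)
  ...       | tri≈ _ eq _  = contradiction (trans (DistIs-unique G a-dist (dist-DistIs x w))
                                           (trans eq (DistIs-unique G (dist-DistIs x w′) b-dist))) a≢b

  shattered-code⇒DualShattered : ∀ {t} (e : Fin t → Fin (k * d)) → ShattersImage code e →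
                                  DualShattered G t (centre ∘ e) (radius ∘ e)
  shattered-code⇒DualShattered {t} e shattered = distinct-balls G (centre ∘ e) (radius ∘ e) realise , realise
    where
    realise : ∀ (S : Subset t) → ∃[ w ] (∀ i → InBall G (centre (e i)) (radius (e i)) w ⇔ (i ∈ S))
    realise S with shattered (lookup S)
    ... | w , same-bits = w , λ i → begin
      InBall G (centre (e i)) (radius (e i)) w   ≈⟨ InBall⇔lookup-code w (e i) ⟩
      lookup (code w) (e i) ≡ true               ≡⟨ cong (_≡ true) (same-bits i) ⟩
      lookup S i ≡ true                          ≈⟨ mk⇔ (lookup⇒[]= i S) []=⇒lookup ⟩
      i ∈ S                                      ∎
      where open ⇔-Reasoning

proposition4 : ∀ {n : ℕ} (G : Graph n) (d k D : ℕ) (R : Subset n) →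
    Connected G → IsDiameter G d → Resolving G R → ∣ R ∣ ≡ k →
    IsDualVCDim G D →
    n ≤ (d * k + 1) ^ D + 1
proposition4 {n} G d k D R _ diam resolving refl (_ , maximal) = begin
  n                       ≤⟨ injective-code-bound D code (code-injective resolving (members-onto R))
                                                  (λ e → maximal _ _ _ ∘ shattered-code⇒DualShattered e) ⟩
  (1 + k * d) ^ D         ≡⟨ cong (_^ D) (trans (+-comm 1 (k * d)) (cong (_+ 1) (*-comm k d))) ⟩
  (d * k + 1) ^ D         ≤⟨ m≤m+n _ 1 ⟩
  (d * k + 1) ^ D + 1     ∎
  where
  open BallCode G diam (members R)
  open ≤-Reasoning
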